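{- Let $n\geq 3$, let $w=w_1\cdots w_n$ be a permutation of $[n]$, and let $k$ be the position of the digit $n-2$ in $w$ (i.e. $w_k=n-2$). Define the words $w_L = w_1,\ w_{k-1}, w_{k-2},\dots,w_3,w_2,\ w_k$ (the middle block $w_{k-1},\dots,w_2$ being empty when $k=2$, so $w_L=w_1w_2$) and $w_R = w_n,\ w_{k+1},w_{k+2},\dots,w_{n-2},w_{n-1},\ w_k$ (the middle block $w_{k+1},\dots,w_{n-1}$ being empty when $k=n-1$). Then: (1) if $w$ is a primitive G-word, then $w_L$ and $w_R$ are primitive G-words; (2) if $w$ is a primitive R-word, then $w_L$ and $w_R$ are primitive R-words.
   Context: For a finite set $P$ of positive integers with $|P|=n$, a permutation $w$ of $P$ is written as a word $w=w_1w_2\cdots w_n$ with $\{w_1,\dots,w_n\}=P$. The reversal of $w$ is $w^*=w_nw_{n-1}\cdots w_1$. A subword of $w$ is a contiguous word $w[i,j]=w_iw_{i+1}\cdots w_j$ with $1\le i\le j\le n$; it is proper if $w[i,j]\neq w$. Let $|P|=n\geq 2$. A permutation $w$ of $P$ is a G-word if (G1) $w_1=\max(P)$ and $w_n=\max(P\setminus\{w_1\})$, and (G2) if $n\geq 4$ then $w_2>w_{n-1}$. It is an R-word if (R1) $w_1=\max(P)$ and $w_n=\max(P\setminus\{w_1\})$, and (R2) if $n\geq 4$ then $w_2<w_{n-1}$. A G-word (resp. R-word) $w$ is primitive if for every proper subword $x$ of $w$ of length at least $4$, neither $x$ nor $x^*$ is a G-word (resp. R-word). The words $w_L,w_R$ are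 permutations of subsets of $[n]$, and the notions above apply to them with $P$ the corresponding set of digits. -}

module Defs where

open import Data.Nat using (ℕ; zero; suc; _∸_; _+_; _≤_; _<_; _>_)
open import Data.List using (List; []; _∷_; _++_; [_]; take; drop; reverse; length)
open import Data.List.Membership.Propositional using (_∈_)
open import Data.List.Relation.Unary.All using (All)
open import Data.List.Relation.Unary.Unique.Propositional using (Unique)
open import Data.Product using (_×_)
open import Relation.Binary.PropositionalEquality using (_≢_)
open import Relation.Nullary using (¬_)

-- 1-indexed letter access: at w i = w_i (default 0 when out of range;
-- only ever used in range).
at : List ℕ → ℕ → ℕ
at []       _             = 0
at (x ∷ xs) zero          = 0
at (x ∷ xs) (suc zero)    = x
at (x ∷ xs) (suc (suc i)) = at xs (suc i)

-- The contiguous subword w[i,j] = w_i w_{i+1} ... w_j (1-indexed;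
-- empty when j < i).
sub : List ℕ → ℕ → ℕ → List ℕ
sub w i j = drop (i ∸ 1) (take j w)

IsMax : ℕ → List ℕ → Set
IsMax m xs = m ∈ xs × All (_≤ m) xs

-- G-word: w is a permutation of its letter set P (distinct letters),
-- |P| ≥ 2, w_1 = max P, w_n = max (P \ {w_1}) (= max of the letters of
-- w_2..w_n, letters being distinct), and w_2 > w_{n-1} if n ≥ 4.
IsG : List ℕ → Set
IsG w = Unique w × 2 ≤ length w
      × IsMax (at w 1) w
      × IsMax (at w (length w)) (drop 1 w)
      × (4 ≤ length w → at w 2 > at w (length w ∸ 1))

IsR : List ℕ → Set
IsR w = Unique w × 2 ≤ length w
      × IsMax (at w 1) w
      × IsMax (at w (length w)) (drop 1 w)
      × (4 ≤ length w → at w 2 < at w (length w ∸ 1))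

PrimitiveWrt : (List ℕ → Set) → List ℕ → Set
PrimitiveWrt Q w = Q w ×
  (∀ i j → 1 ≤ i → i ≤ j → j ≤ length w → sub w i j ≢ w →
     4 ≤ length (sub w i j) →
     ¬ Q (sub w i j) × ¬ Q (reverse (sub w i j)))

PrimitiveG : List ℕ → Set
PrimitiveG = PrimitiveWrt IsG

PrimitiveR : List ℕ → Set
PrimitiveR = PrimitiveWrt IsR

wL : List ℕ → ℕ → List ℕ
wL w k = at w 1 ∷ (reverse (sub w 2 (k ∸ 1)) ++ [ at w k ])

wR : List ℕ → ℕ → List ℕ
wR w k = at w (length w) ∷ (sub w (k + 1) (length w ∸ 1) ++ [ at w k ])

-- Since w is a G- (or R-) word of [n], w = n A (n-2) B (n-1) with every letter of A and B below
-- n-2, so w_L = n A* (n-2) and w_R = (n-1) B (n-2). Both have the form h Y* t where u = h Y t,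
-- with Y < t < h, is a proper infix of w or of w*; hence no infix of u of length ≥ 4 is a Q-word
-- or the reversal of one (Q = G or R). Such a flip h Y* t is a primitive Q-word: its end condition
-- holds because u itself is not a Q-word, and a proper infix either lies inside Y*, so that its
-- reversal is an infix of u, or contains one end letter. Read so that this end letter comes last,
-- it is not a Q-word since its last letter exceeds its first; read the other way, exchanging h
-- and t at that end keeps Q-words Q-words and yields the reversal of an infix of u.

module Submission where

open import Defs
open import Data.Nat using (ℕ; zero; suc; _∸_; _+_; _≤_; _<_; _>_; z≤n; s≤s)
open import Data.Nat.Properties
  using (≤-refl; ≤-reflexive; ≤-trans; ≤-pred; +-monoʳ-≤; <-trans; <-irrefl; <⇒≤; <⇒≱; >⇒≢; ≮⇒≥; ≤∧≢⇒<;
         m<m+n; 1+n≰n; n≤1+n)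
open import Data.List using (List; []; _∷_; _++_; [_]; take; drop; reverse; length; map; upTo)
open import Data.List.Properties
  using (++-assoc; ++-identityʳ; ++-conicalˡ; ++-conicalʳ; unfold-reverse; reverse-++; reverse-involutive;
         ∷-injective; ∷ʳ-injective; take++drop≡id; length-++; length-++-≤ˡ; length-++-≤ʳ;
         length-reverse)
open import Data.List.Reverse using (reverseView; []; _∶_∶ʳ_)
open import Data.List.Relation.Unary.All as All using (All; []; _∷_)
open import Data.List.Relation.Unary.All.Properties using (++⁺; ++⁻)
open import Data.List.Relation.Unary.Any using (here; there)
open import Data.List.Relation.Unary.Unique.Propositional using (Unique; []; _∷_)
open import Data.List.Membership.Propositional using (_∈_)
open import Data.List.Membership.Propositional.Properties
  using (∈-++⁺ʳ; ∈-++⁺ˡ; ∈-map⁺; ∈-map⁻; ∈-upTo⁺; ∈-upTo⁻)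
open import Data.List.Relation.Binary.Permutation.Propositional using (_↭_; ↭-sym; ↭-prep; ↭⇒↭ₛ)
open import Data.List.Relation.Binary.Permutation.Propositional.Properties
  using (All-resp-↭; ∈-resp-↭; ↭-reverse; ++⁺ʳ; shift)
import Data.List.Relation.Binary.Permutation.Setoid.Properties as ↭ₛ
open import Data.Product using (_×_; _,_; proj₁; proj₂; ∃-syntax)
open import Data.Sum using (_⊎_; inj₁; inj₂) renaming (map to ⊎-map)
open import Data.Empty using (⊥-elim)
open import Relation.Binary.PropositionalEquality
  using (_≡_; _≢_; refl; sym; trans; cong; cong₂; subst; ≢-sym; setoid; module ≡-Reasoning)
open import Relation.Nullary using (¬_)
open import Function using (_∘_)

module _ {E : Set} where

  length-∷ʳ : (xs : List E) (x : E) → length (xs ++ [ x ]) ≡ suc (length xs)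
  length-∷ʳ []       x = refl
  length-∷ʳ (_ ∷ xs) x = cong suc (length-∷ʳ xs x)

  take-length-++ : (xs ys : List E) → take (length xs) (xs ++ ys) ≡ xs
  take-length-++ []       ys = refl
  take-length-++ (x ∷ xs) ys = cong (x ∷_) (take-length-++ xs ys)

  drop-length-++-∷ : (xs : List E) (x : E) (ys : List E) → drop (length xs + 1) (xs ++ x ∷ ys) ≡ ys
  drop-length-++-∷ []       x ys = refl
  drop-length-++-∷ (_ ∷ xs) x ys = drop-length-++-∷ xs x ys

  split-∷ʳ : (ys xs zs : List E) (y : E) → ys ++ [ y ] ≡ xs ++ zs → zs ≢ [] →
             ∃[ zs′ ] zs ≡ zs′ ++ [ y ] × ys ≡ xs ++ zs′
  split-∷ʳ ys       []       zs y eq ne = ys , sym eq , refl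
  split-∷ʳ []       (_ ∷ []) zs y eq ne = ⊥-elim (ne (sym (proj₂ (∷-injective eq))))
  split-∷ʳ []       (_ ∷ _ ∷ _) zs y ()
  split-∷ʳ (v ∷ ys) (x ∷ xs) zs y eq ne with refl , eq′ ← ∷-injective eq
                                       with zs′ , refl , refl ← split-∷ʳ ys xs zs y eq′ ne
    = zs′ , refl , refl

  reverse-framed : (x : E) (xs : List E) (y : E) → reverse (x ∷ xs ++ [ y ]) ≡ y ∷ reverse xs ++ [ x ]
  reverse-framed x xs y = trans (unfold-reverse x (xs ++ [ y ])) (cong (_++ [ x ]) (reverse-++ xs [ y ]))

  reverse-infix : (xs ys zs : List E) → reverse (xs ++ ys ++ zs) ≡ reverse zs ++ reverse ys ++ reverse xs
  reverse-infix xs ys zs = begin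
    reverse (xs ++ ys ++ zs)              ≡⟨ reverse-++ xs (ys ++ zs) ⟩
    reverse (ys ++ zs) ++ reverse xs      ≡⟨ cong (_++ reverse xs) (reverse-++ ys zs) ⟩
    (reverse zs ++ reverse ys) ++ reverse xs ≡⟨ ++-assoc (reverse zs) (reverse ys) (reverse xs) ⟩
    reverse zs ++ reverse ys ++ reverse xs ∎
    where open ≡-Reasoning

  nonempty : {X : List E} → 1 ≤ length X → X ≢ []
  nonempty {X = _ ∷ _} _ ()

  proper⇒shorter : (P X S : List E) → P ≢ [] ⊎ S ≢ [] → length X < length (P ++ X ++ S)
  proper⇒shorter (_ ∷ P) X S       _ = s≤s (≤-trans (length-++-≤ˡ X) (length-++-≤ʳ (X ++ S) {P}))
  proper⇒shorter []      X (_ ∷ S) _ = subst (length X <_) (sym (length-++ X)) (m<m+n (length X) (s≤s z≤n))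
  proper⇒shorter []      X []      (inj₁ P≢[]) = ⊥-elim (P≢[] refl)
  proper⇒shorter []      X []      (inj₂ S≢[]) = ⊥-elim (S≢[] refl)

  proper-if-≢ : (P X S : List E) → X ≢ P ++ X ++ S → P ≢ [] ⊎ S ≢ []
  proper-if-≢ []      X []      X≢X = ⊥-elim (X≢X (sym (++-identityʳ X)))
  proper-if-≢ []      X (_ ∷ _) _   = inj₂ λ ()
  proper-if-≢ (_ ∷ _) X S       _   = inj₁ λ ()

  Unique-resp-↭ : {xs ys : List E} → xs ↭ ys → Unique xs → Unique ys
  Unique-resp-↭ p = ↭ₛ.Unique-resp-↭ (setoid E) (↭⇒↭ₛ p)

  Unique-infix : (xs ys zs : List E) → Unique (xs ++ ys ++ zs) → Unique ys
  Unique-infix (_ ∷ xs) ys zs (_ ∷ u) = Unique-infix xs ys zs u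
  Unique-infix []       []       zs u       = []
  Unique-infix []       (y ∷ ys) zs (y∉ ∷ u) = proj₁ (++⁻ ys y∉) ∷ Unique-infix [] ys zs u

  Unique-shift : (xs : List E) (y : E) (ys : List E) → Unique (xs ++ y ∷ ys) → All (y ≢_) (xs ++ ys)
  Unique-shift xs y ys u with y∉ ∷ _ ← Unique-resp-↭ (shift y xs ys) u = y∉

  All-reverse : {P : E → Set} {xs : List E} → All P xs → All P (reverse xs)
  All-reverse {xs = xs} = All-resp-↭ (↭-sym (↭-reverse xs))

at-middle : (xs : List ℕ) (x : ℕ) (ys : List ℕ) → at (xs ++ x ∷ ys) (suc (length xs)) ≡ x
at-middle []       x ys = refl
at-middle (_ ∷ xs) x ys = at-middle xs x ys

at-last : (xs : List ℕ) (x : ℕ) → at (xs ++ [ x ]) (length (xs ++ [ x ])) ≡ x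
at-last xs x = subst (λ i → at (xs ++ [ x ]) i ≡ x) (sym (length-∷ʳ xs x)) (at-middle xs x [])

at-last-++ : (xs ys : List ℕ) (y : ℕ) → at (xs ++ ys ++ [ y ]) (length (xs ++ ys ++ [ y ])) ≡ y
at-last-++ xs ys y = subst (λ zs → at zs (length zs) ≡ y) (++-assoc xs ys [ y ]) (at-last (xs ++ ys) y)

at-penultimate : (xs : List ℕ) (x y : ℕ) →
                 at ((xs ++ [ x ]) ++ [ y ]) (length ((xs ++ [ x ]) ++ [ y ]) ∸ 1) ≡ x
at-penultimate xs x y = begin
  at ((xs ++ [ x ]) ++ [ y ]) (length ((xs ++ [ x ]) ++ [ y ]) ∸ 1)
    ≡⟨ cong (λ i → at ((xs ++ [ x ]) ++ [ y ]) (i ∸ 1))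
            (trans (length-∷ʳ (xs ++ [ x ]) y) (cong suc (length-∷ʳ xs x))) ⟩
  at ((xs ++ [ x ]) ++ [ y ]) (suc (length xs))
    ≡⟨ cong (λ zs → at zs (suc (length xs))) (++-assoc xs [ x ] [ y ]) ⟩
  at (xs ++ x ∷ y ∷ []) (suc (length xs))
    ≡⟨ at-middle xs x [ y ] ⟩
  x ∎
  where open ≡-Reasoning

-- `at` returns 0 outside the word, hence the hypothesis v ≢ 0.
at-split : (xs : List ℕ) (i : ℕ) {v : ℕ} → at xs (suc i) ≡ v → v ≢ 0 →
           ∃[ ys ] ∃[ zs ] xs ≡ ys ++ v ∷ zs × length ys ≡ i
at-split []       i       e v≢0 = ⊥-elim (v≢0 (sym e))
at-split (x ∷ xs) zero    refl v≢0 = [] , xs , refl , refl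
at-split (x ∷ xs) (suc i) e v≢0 with ys , zs , refl , refl ← at-split xs i e v≢0 =
  x ∷ ys , zs , refl , refl

sub-infix : (xs ys zs : List ℕ) → sub (xs ++ ys ++ zs) (suc (length xs)) (length xs + length ys) ≡ ys
sub-infix []       ys zs = take-length-++ ys zs
sub-infix (_ ∷ xs) ys zs = sub-infix xs ys zs

take-sub-drop : (w : List ℕ) (i j : ℕ) → take (i ∸ 1) (take j w) ++ sub w i j ++ drop j w ≡ w
take-sub-drop w i j = begin
  take (i ∸ 1) (take j w) ++ drop (i ∸ 1) (take j w) ++ drop j w
    ≡⟨ sym (++-assoc (take (i ∸ 1) (take j w)) _ (drop j w)) ⟩
  (take (i ∸ 1) (take j w) ++ drop (i ∸ 1) (take j w)) ++ drop j w
    ≡⟨ cong (_++ drop j w) (take++drop≡id (i ∸ 1) (take j w)) ⟩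
  take j w ++ drop j w
    ≡⟨ take++drop≡id j w ⟩
  w ∎
  where open ≡-Reasoning

data ProperInfix {E : Set} (h : E) (M : List E) (t : E) : List E → Set where
  initial  : ∀ {X S}   → M ≡ X ++ S      → ProperInfix h M t (h ∷ X)
  final    : ∀ {P X}   → M ≡ P ++ X      → ProperInfix h M t (X ++ [ t ])
  interior : ∀ {P X S} → M ≡ P ++ X ++ S → ProperInfix h M t X

properInfix : {E : Set} {h t : E} (M P X S : List E) → h ∷ M ++ [ t ] ≡ P ++ X ++ S →
              P ≢ [] ⊎ S ≢ [] → X ≢ [] → ProperInfix h M t X
properInfix M []      []      S       _  _                X≢[] = ⊥-elim (X≢[] refl)
properInfix M []      (_ ∷ X) []      _  (inj₁ []≢[])     _    = ⊥-elim ([]≢[] refl)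
properInfix M []      (_ ∷ X) []      _  (inj₂ []≢[])     _    = ⊥-elim ([]≢[] refl)
properInfix M []      (_ ∷ X) (s ∷ S) eq _                _
  with refl , eq′ ← ∷-injective eq
  with _ , _ , M≡ ← split-∷ʳ M X (s ∷ S) _ eq′ (λ ())
  = initial M≡
properInfix M (_ ∷ P) X       []      eq _                X≢[]
  with refl , eq′ ← ∷-injective eq
  with _ , refl , M≡ ← split-∷ʳ M P X _ (trans eq′ (cong (P ++_) (++-identityʳ X))) X≢[]
  = final M≡
properInfix M (_ ∷ P) X       (s ∷ S) eq _                _
  with refl , eq′ ← ∷-injective eq
  with S′ , _ , M≡ ← split-∷ʳ M (P ++ X) (s ∷ S) _ (trans eq′ (sym (++-assoc P X (s ∷ S)))) (λ ())
  = interior {P = P} {S = S′} (trans M≡ (++-assoc P X S′))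

module Infixes (Q : List ℕ → Set) where

  Avoids : List ℕ → Set
  Avoids X = ¬ Q X × ¬ Q (reverse X)

  Free : List ℕ → Set
  Free u = ∀ P X S → u ≡ P ++ X ++ S → 4 ≤ length X → Avoids X

  -- The second half of PrimitiveWrt Q, with subwords given as infixes P ++ X ++ S instead of by indices.
  ProperlyFree : List ℕ → Set
  ProperlyFree w = ∀ P X S → w ≡ P ++ X ++ S → P ≢ [] ⊎ S ≢ [] → 4 ≤ length X → Avoids X

  Avoids-reverse⁻ : {X : List ℕ} → Avoids (reverse X) → Avoids X
  Avoids-reverse⁻ {X} (¬Q-rev , ¬Q-rev-rev) = subst (¬_ ∘ Q) (reverse-involutive X) ¬Q-rev-rev , ¬Q-rev

  primitive⇒properlyFree : {w : List ℕ} → PrimitiveWrt Q w → ProperlyFree w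
  primitive⇒properlyFree (_ , avoid) P X S refl proper 4≤ =
    subst Avoids sub≡X
      (avoid (suc (length P)) (length P + length X) (s≤s z≤n)
             (m<m+n (length P) (≤-trans (s≤s z≤n) 4≤))
             (≤-trans (+-monoʳ-≤ (length P) (length-++-≤ˡ X)) (≤-reflexive (sym (length-++ P))))
             (λ sub≡w → <-irrefl (cong length (trans (sym sub≡X) sub≡w)) (proper⇒shorter P X S proper))
             (subst (λ Y → 4 ≤ length Y) (sym sub≡X) 4≤))
    where
    sub≡X : sub (P ++ X ++ S) (suc (length P)) (length P + length X) ≡ X
    sub≡X = sub-infix P X S

  properlyFree⇒primitive : {w : List ℕ} → Q w → ProperlyFree w → PrimitiveWrt Q w
  properlyFree⇒primitive {w} q free = q , λ i j _ _ _ sub≢w 4≤ →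
    let P = take (i ∸ 1) (take j w)
        S = drop j w
        w≡ = sym (take-sub-drop w i j)
    in free P (sub w i j) S w≡ (proper-if-≢ P (sub w i j) S (subst (sub w i j ≢_) w≡ sub≢w)) 4≤

  properlyFree⇒free : {w u : List ℕ} (P S : List ℕ) → ProperlyFree w → w ≡ P ++ u ++ S →
                      P ≢ [] ⊎ S ≢ [] → Free u
  properlyFree⇒free P S free refl proper P′ X S′ refl =
    free (P ++ P′) X (S′ ++ S) regroup
         (⊎-map (λ P≢[] → P≢[] ∘ ++-conicalˡ P P′) (λ S≢[] → S≢[] ∘ ++-conicalʳ S′ S) proper)
    where
    open ≡-Reasoning
    regroup : P ++ (P′ ++ X ++ S′) ++ S ≡ (P ++ P′) ++ X ++ S′ ++ S
    regroup = begin
      P ++ (P′ ++ X ++ S′) ++ S   ≡⟨ cong (P ++_) (++-assoc P′ (X ++ S′) S) ⟩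
      P ++ P′ ++ (X ++ S′) ++ S   ≡⟨ cong (λ Y → P ++ P′ ++ Y) (++-assoc X S′ S) ⟩
      P ++ P′ ++ X ++ S′ ++ S     ≡⟨ sym (++-assoc P P′ (X ++ S′ ++ S)) ⟩
      (P ++ P′) ++ X ++ S′ ++ S   ∎

  free-reverse : {u : List ℕ} → Free u → Free (reverse u)
  free-reverse {u} free P X S eq 4≤ =
    Avoids-reverse⁻ (free (reverse S) (reverse X) (reverse P) u≡ (subst (4 ≤_) (sym (length-reverse X)) 4≤))
    where
    u≡ : u ≡ reverse S ++ reverse X ++ reverse P
    u≡ = trans (sym (reverse-involutive u)) (trans (cong reverse eq) (reverse-infix P X S))

  free-properInfix : {h t : ℕ} {Y X : List ℕ} → Free (h ∷ Y ++ [ t ]) → ProperInfix h Y t X →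
                     4 ≤ length X → Avoids X
  free-properInfix {h} {t} free (initial {X} {S} refl) =
    free [] (h ∷ X) (S ++ [ t ]) (cong (h ∷_) (++-assoc X S [ t ]))
  free-properInfix {h} {t} free (final {P} {X} refl) =
    free (h ∷ P) (X ++ [ t ]) [] (cong (h ∷_) (trans (++-assoc P X [ t ]) (cong (P ++_) (sym (++-identityʳ _)))))
  free-properInfix {h} {t} free (interior {P} {X} {S} refl) =
    free (h ∷ P) X (S ++ [ t ])
         (cong (h ∷_) (trans (++-assoc P (X ++ S) [ t ]) (cong (P ++_) (++-assoc X S [ t ]))))

letter≤ : {w : List ℕ} {n x : ℕ} → w ↭ map suc (upTo n) → x ∈ w → x ≤ n
letter≤ w↭ x∈w with _ , y∈ , refl ← ∈-map⁻ suc (∈-resp-↭ w↭ x∈w) = ∈-upTo⁻ y∈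

letter∈ : {w : List ℕ} {n x : ℕ} → w ↭ map suc (upTo n) → suc x ≤ n → suc x ∈ w
letter∈ w↭ x<n = ∈-resp-↭ (↭-sym w↭) (∈-map⁺ suc (∈-upTo⁺ x<n))

head-strict : {x : ℕ} {xs : List ℕ} → Unique (x ∷ xs) → All (_≤ x) xs → All (_< x) xs
head-strict (x∉ ∷ _) ≤x = All.zipWith (λ (y≤x , x≢y) → ≤∧≢⇒< y≤x (≢-sym x≢y)) (≤x , x∉)

last-strict : {x : ℕ} (xs : List ℕ) → Unique (xs ++ [ x ]) → All (_≤ x) xs → All (_< x) xs
last-strict []       _        []         = []
last-strict (y ∷ xs) (y∉ ∷ u) (y≤x ∷ ≤x) =
  ≤∧≢⇒< y≤x (All.lookup y∉ (∈-++⁺ʳ xs (here refl))) ∷ last-strict xs u ≤x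

data Layout (c : ℕ) : List ℕ → ℕ → Set where
  layout : ∀ {a A B b} → All (_< c) A → All (_< c) B → c < b → b < a →
           Layout c (a ∷ A ++ c ∷ B ++ [ b ]) (2 + length A)

-- In a permutation w of [n] whose first letter is its maximum and whose last letter is the
-- maximum of the rest, these two letters are n and n-1, so every other letter is below n-2.
layout-of : {w : List ℕ} {k : ℕ} (n : ℕ) → 3 ≤ n → w ↭ map suc (upTo n) → Unique w →
            IsMax (at w 1) w → IsMax (at w (length w)) (drop 1 w) → at w k ≡ n ∸ 2 → Layout (n ∸ 2) w k
layout-of {[]}                     (suc (suc (suc m))) (s≤s (s≤s (s≤s _))) _ _ _ _ ()
layout-of {_ ∷ _} {zero}           (suc (suc (suc m))) (s≤s (s≤s (s≤s _))) _ _ _ _ ()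
layout-of {_ ∷ _} {suc zero}       (suc (suc (suc m))) (s≤s (s≤s (s≤s _))) w↭ _ (_ , ≤a) _ refl =
  ⊥-elim (1+n≰n (≤-trans (n≤1+n _) (≤-pred (All.lookup ≤a (letter∈ w↭ ≤-refl)))))
layout-of {a ∷ rest} {suc (suc i)} (suc (suc (suc m))) (s≤s (s≤s (s≤s _)))
          w↭ u@(_ ∷ u-rest) (_ , ≤a) (_ , ≤last) wₖ
  with A , B′ , refl , refl ← at-split rest i wₖ (λ ())
  with reverseView B′
... | B ∶ _ ∶ʳ b = layout (below-c A<b c≢A) (below-c B<b c≢B) c<b b<a
  where
  c = suc m
  rest<a : All (_< a) (A ++ c ∷ B ++ [ b ])
  rest<a = head-strict u (All.tail ≤a)
  b<a : b < a
  b<a = All.lookup rest<a (∈-++⁺ʳ A (there (∈-++⁺ʳ B (here refl))))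
  regroup : (A ++ c ∷ B) ++ [ b ] ≡ A ++ c ∷ B ++ [ b ]
  regroup = ++-assoc A (c ∷ B) [ b ]
  ≤b : All (_≤ b) ((A ++ c ∷ B) ++ [ b ])
  ≤b = subst (All (_≤ b)) (sym regroup) (subst (λ z → All (_≤ z) _) (at-last-++ (a ∷ A) (c ∷ B) b) ≤last)
  <b : All (_< b) (A ++ c ∷ B)
  <b = last-strict (A ++ c ∷ B) (subst Unique (sym regroup) u-rest) (proj₁ (++⁻ (A ++ c ∷ B) ≤b))
  A<b = proj₁ (++⁻ A <b)
  c<b = All.head (proj₂ (++⁻ A <b))
  B<b = All.tail (proj₂ (++⁻ A <b))
  c∉ : All (c ≢_) (A ++ B ++ [ b ])
  c∉ = Unique-shift A c (B ++ [ b ]) u-rest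
  c≢A = proj₁ (++⁻ A c∉)
  c≢B = proj₁ (++⁻ B (proj₂ (++⁻ A c∉)))
  b≤c+1 : b ≤ suc c
  b≤c+1 = ≤-pred (≤-trans b<a (letter≤ w↭ (here refl)))
  below-c : {X : List ℕ} → All (_< b) X → All (c ≢_) X → All (_< c) X
  below-c X<b c≢X =
    All.zipWith (λ (x<b , c≢x) → ≤∧≢⇒< (≤-pred (≤-trans x<b b≤c+1)) (≢-sym c≢x)) (X<b , c≢X)
... | [] with letter∈ w↭ (n≤1+n _)
...   | here n-1≡a =
  ⊥-elim (1+n≰n (subst (suc (suc (suc m)) ≤_) (sym n-1≡a) (All.lookup ≤a (letter∈ w↭ ≤-refl))))
...   | there n-1∈ =
  ⊥-elim (1+n≰n (All.lookup (subst (λ z → All (_≤ z) rest) (at-last (a ∷ A) (suc m)) ≤last) n-1∈))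

wL-layout : (a : ℕ) (A : List ℕ) (c : ℕ) (B : List ℕ) (b : ℕ) →
            wL (a ∷ A ++ c ∷ B ++ [ b ]) (2 + length A) ≡ a ∷ reverse A ++ [ c ]
wL-layout a A c B b = cong₂ (λ X x → a ∷ reverse X ++ [ x ]) (take-length-++ A _) (at-middle A c _)

wR-layout : (a : ℕ) (A : List ℕ) (c : ℕ) (B : List ℕ) (b : ℕ) →
            wR (a ∷ A ++ c ∷ B ++ [ b ]) (2 + length A) ≡ b ∷ B ++ [ c ]
wR-layout a A c B b =
  trans (cong₂ (λ x X → x ∷ X ++ [ at (A ++ c ∷ B ++ [ b ]) (suc (length A)) ])
               (at-last-++ (a ∷ A) (c ∷ B) b) middle)
        (cong (λ y → b ∷ B ++ [ y ]) (at-middle A c _))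
  where
  open ≡-Reasoning
  middle : drop (suc (length A + 1)) (take (length (A ++ c ∷ B ++ [ b ])) (a ∷ A ++ c ∷ B ++ [ b ])) ≡ B
  middle = begin
    drop (suc (length A + 1)) (take (length (A ++ c ∷ B ++ [ b ])) (a ∷ A ++ c ∷ B ++ [ b ]))
      ≡⟨ cong (λ Z → drop (suc (length A + 1)) (take (length Z) (a ∷ Z))) (sym (++-assoc A (c ∷ B) [ b ])) ⟩
    drop (suc (length A + 1)) (take (length ((A ++ c ∷ B) ++ [ b ])) (a ∷ (A ++ c ∷ B) ++ [ b ]))
      ≡⟨ cong (λ i → drop (suc (length A + 1)) (take i (a ∷ (A ++ c ∷ B) ++ [ b ])))
              (length-∷ʳ (A ++ c ∷ B) b) ⟩
    drop (length A + 1) (take (length (A ++ c ∷ B)) ((A ++ c ∷ B) ++ [ b ]))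
      ≡⟨ cong (drop (length A + 1)) (take-length-++ (A ++ c ∷ B) [ b ]) ⟩
    drop (length A + 1) (A ++ c ∷ B)
      ≡⟨ drop-length-++-∷ A c B ⟩
    B ∎

module Framed (R : ℕ → ℕ → Set) (connected : ∀ {p q} → ¬ R p q → p ≢ q → R q p) where

  Q : List ℕ → Set
  Q w = Unique w × 2 ≤ length w
      × IsMax (at w 1) w
      × IsMax (at w (length w)) (drop 1 w)
      × (4 ≤ length w → R (at w 2) (at w (length w ∸ 1)))

  open Infixes Q

  Ends : List ℕ → Set
  Ends Y = ∀ {x M y} → Y ≡ x ∷ M ++ [ y ] → R x y

  ends-intro : {x y : ℕ} (M : List ℕ) → R x y → Ends (x ∷ M ++ [ y ])
  ends-intro M r {M = M′} eq with refl , eq′ ← ∷-injective eq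
                             with _ , refl ← ∷ʳ-injective M M′ eq′ = r

  Q-ends : (h : ℕ) (Y : List ℕ) (t : ℕ) → Ends Y → 4 ≤ length (h ∷ Y ++ [ t ]) →
           R (at (h ∷ Y ++ [ t ]) 2) (at (h ∷ Y ++ [ t ]) (length (h ∷ Y ++ [ t ]) ∸ 1))
  Q-ends h []      t _    (s≤s (s≤s ()))
  Q-ends h (x ∷ Z) t ends 4≤ with reverseView Z
  Q-ends h (x ∷ .[]) t ends (s≤s (s≤s (s≤s ()))) | []
  ... | M ∶ _ ∶ʳ y = subst (R x) (sym (at-penultimate (h ∷ x ∷ M) y t)) (ends refl)

  Q-intro : {h t : ℕ} {Y : List ℕ} → Unique (h ∷ Y ++ [ t ]) → All (_< t) Y → t < h → Ends Y →
            Q (h ∷ Y ++ [ t ])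
  Q-intro {h} {t} {Y} u Y<t t<h ends = u , 2≤ , head-max , last-max , Q-ends h Y t ends
    where
    2≤ : 2 ≤ length (h ∷ Y ++ [ t ])
    2≤ = subst (λ n → 2 ≤ suc n) (sym (length-∷ʳ Y t)) (s≤s (s≤s z≤n))
    below-t : All (_≤ t) (Y ++ [ t ])
    below-t = ++⁺ (All.map <⇒≤ Y<t) (≤-refl ∷ [])
    head-max : IsMax h (h ∷ Y ++ [ t ])
    head-max = here refl , ≤-refl ∷ All.map (λ x≤t → ≤-trans x≤t (<⇒≤ t<h)) below-t
    last-max : IsMax (at (h ∷ Y ++ [ t ]) (length (h ∷ Y ++ [ t ]))) (Y ++ [ t ])
    last-max = subst (λ z → IsMax z (Y ++ [ t ])) (sym (at-last (h ∷ Y) t)) (∈-++⁺ʳ Y (here refl) , below-t)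

  Q-replace-head : {a b : ℕ} (xs : List ℕ) → All (_< b) xs → Q (a ∷ xs) → Q (b ∷ xs)
  Q-replace-head []           _    (_ , s≤s () , _)
  Q-replace-head (x ∷ [])     xs<b ((_ ∷ u) , 2≤ , _ , last-max , _) =
    (All.map >⇒≢ xs<b ∷ u) , 2≤ , (here refl , ≤-refl ∷ All.map <⇒≤ xs<b) , last-max ,
    λ { (s≤s (s≤s ())) }
  Q-replace-head (x ∷ y ∷ xs) xs<b ((_ ∷ u) , 2≤ , _ , last-max , ends) =
    (All.map >⇒≢ xs<b ∷ u) , 2≤ , (here refl , ≤-refl ∷ All.map <⇒≤ xs<b) , last-max , ends

  ¬Q-below-last : {z : ℕ} (Y : List ℕ) → All (_< z) Y → ¬ Q (Y ++ [ z ])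
  ¬Q-below-last []      _         (_ , s≤s () , _)
  ¬Q-below-last (y ∷ Y) (y<z ∷ _) (_ , _ , (_ , ≤y) , _) =
    <⇒≱ y<z (All.lookup ≤y (there (∈-++⁺ʳ Y (here refl))))

  length-framed : (h x : ℕ) (M : List ℕ) (y t : ℕ) → length (h ∷ (x ∷ M ++ [ y ]) ++ [ t ]) ≡ 4 + length M
  length-framed h x M y t =
    cong (suc ∘ suc) (trans (length-∷ʳ (M ++ [ y ]) t) (cong suc (length-∷ʳ M y)))

  flip-Q : {h t : ℕ} {M : List ℕ} → Unique (h ∷ reverse M ++ [ t ]) → All (_< t) M → t < h →
           Free (h ∷ reverse M ++ [ t ]) → Q (h ∷ M ++ [ t ])
  flip-Q {h} {t} {M} u M<t t<h free = Q-intro u′ M<t t<h ends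
    where
    u′ : Unique (h ∷ M ++ [ t ])
    u′ = Unique-resp-↭ (↭-prep h (++⁺ʳ [ t ] (↭-reverse M))) u
    ends : Ends M
    ends {x} {N} {y} M≡ = connected ¬Ryx (≢-sym x≢y)
      where
      revM≡ : reverse M ≡ y ∷ reverse N ++ [ x ]
      revM≡ = trans (cong reverse M≡) (reverse-framed x N y)
      x≢y : x ≢ y
      x≢y with _ ∷ x∉ ∷ _ ← subst (λ Z → Unique (h ∷ Z ++ [ t ])) M≡ u′ =
        All.lookup x∉ (∈-++⁺ˡ (∈-++⁺ʳ N (here refl)))
      -- If R y x held, the source word itself would be a Q-word of length ≥ 4.
      ¬Ryx : ¬ R y x
      ¬Ryx r = proj₁ (free [] _ [] (sym (++-identityʳ _)) 4≤)
                     (Q-intro u (All-reverse M<t) t<h (subst Ends (sym revM≡) (ends-intro (reverse N) r)))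
        where
        4≤ : 4 ≤ length (h ∷ reverse M ++ [ t ])
        4≤ = subst (λ Z → 4 ≤ length (h ∷ Z ++ [ t ])) (sym revM≡)
               (subst (4 ≤_) (sym (length-framed h y (reverse N) x t)) (s≤s (s≤s (s≤s (s≤s z≤n)))))

  flip-properlyFree : {h t : ℕ} (M : List ℕ) → All (_< t) M → t < h → Free (h ∷ reverse M ++ [ t ]) →
                      ProperlyFree (h ∷ M ++ [ t ])
  flip-properlyFree {h} {t} M M<t t<h free P X S eq proper 4≤
    with properInfix M P X S eq proper (nonempty (≤-trans (s≤s z≤n) 4≤))
  ... | initial {X′} {S′} refl = ¬Q-initial , ¬Q-initial-reversed
    where
    X′<t : All (_< t) X′
    X′<t = proj₁ (++⁻ X′ M<t)
    mirror : ProperInfix h (reverse (X′ ++ S′)) t (reverse X′ ++ [ t ])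
    mirror = final (reverse-++ X′ S′)
    4≤′ : 4 ≤ length (reverse X′ ++ [ t ])
    4≤′ = subst (4 ≤_) (sym (trans (length-∷ʳ (reverse X′) t) (cong suc (length-reverse X′)))) 4≤
    mirror-reversed : reverse (reverse X′ ++ [ t ]) ≡ t ∷ X′
    mirror-reversed = trans (reverse-++ (reverse X′) [ t ]) (cong (t ∷_) (reverse-involutive X′))
    ¬Q-initial : ¬ Q (h ∷ X′)
    ¬Q-initial q =
      proj₂ (free-properInfix free mirror 4≤′) (subst Q (sym mirror-reversed) (Q-replace-head X′ X′<t q))
    ¬Q-initial-reversed : ¬ Q (reverse (h ∷ X′))
    ¬Q-initial-reversed q =
      ¬Q-below-last (reverse X′) (All-reverse (All.map (λ x<t → <-trans x<t t<h) X′<t))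
                    (subst Q (unfold-reverse h X′) q)
  ... | final {P′} {X″} refl = ¬Q-below-last X″ X″<t , ¬Q-final-reversed
    where
    X″<t : All (_< t) X″
    X″<t = proj₂ (++⁻ P′ M<t)
    mirror : ProperInfix h (reverse (P′ ++ X″)) t (h ∷ reverse X″)
    mirror = initial (reverse-++ P′ X″)
    4≤′ : 4 ≤ length (h ∷ reverse X″)
    4≤′ = subst (4 ≤_) (trans (length-∷ʳ X″ t) (cong suc (sym (length-reverse X″)))) 4≤
    ¬Q-final-reversed : ¬ Q (reverse (X″ ++ [ t ]))
    ¬Q-final-reversed q = proj₁ (free-properInfix free mirror 4≤′)
      (Q-replace-head (reverse X″) (All-reverse (All.map (λ x<t → <-trans x<t t<h) X″<t))
                    (subst Q (reverse-++ X″ [ t ]) q))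
  ... | interior {P′} {_} {S′} refl =
    Avoids-reverse⁻ (free-properInfix free (interior {P = reverse S′} {S = reverse P′} (reverse-infix P′ X S′))
                                      (subst (4 ≤_) (sym (length-reverse X)) 4≤))

  flip-primitive : {h t : ℕ} (M : List ℕ) → Unique (h ∷ reverse M ++ [ t ]) → All (_< t) M → t < h →
                   Free (h ∷ reverse M ++ [ t ]) → PrimitiveWrt Q (h ∷ M ++ [ t ])
  flip-primitive M u M<t t<h free =
    properlyFree⇒primitive (flip-Q u M<t t<h free) (flip-properlyFree M M<t t<h free)

  primitive-wL-wR : (n : ℕ) → 3 ≤ n → {w : List ℕ} → w ↭ map suc (upTo n) → {k : ℕ} →
                    at w k ≡ n ∸ 2 → PrimitiveWrt Q w → PrimitiveWrt Q (wL w k) × PrimitiveWrt Q (wR w k)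
  primitive-wL-wR n 3≤n w↭ wₖ prim@((u , _ , head-max , last-max , _) , _)
    with layout-of n 3≤n w↭ u head-max last-max wₖ
  ... | layout {a} {A} {B} {b} A<c B<c c<b b<a =
    subst (PrimitiveWrt Q) (sym (wL-layout a A c B b))
          (flip-primitive (reverse A) u-left (All-reverse A<c) (<-trans c<b b<a) free-left) ,
    subst (PrimitiveWrt Q) (sym (wR-layout a A c B b))
          (flip-primitive B u-right B<c c<b free-right)
    where
    c = n ∸ 2
    w-free : ProperlyFree (a ∷ A ++ c ∷ B ++ [ b ])
    w-free = primitive⇒properlyFree prim
    left : a ∷ A ++ c ∷ B ++ [ b ] ≡ [] ++ (a ∷ reverse (reverse A) ++ [ c ]) ++ B ++ [ b ]
    left = cong (a ∷_) (trans (sym (++-assoc A [ c ] (B ++ [ b ])))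
                              (cong (λ Z → (Z ++ [ c ]) ++ B ++ [ b ]) (sym (reverse-involutive A))))
    right : a ∷ A ++ c ∷ B ++ [ b ] ≡ (a ∷ A) ++ (c ∷ B ++ [ b ]) ++ []
    right = cong (λ Z → a ∷ A ++ Z) (sym (++-identityʳ _))
    u-left : Unique (a ∷ reverse (reverse A) ++ [ c ])
    u-left = Unique-infix [] _ (B ++ [ b ]) (subst Unique left u)
    free-left : Free (a ∷ reverse (reverse A) ++ [ c ])
    free-left = properlyFree⇒free [] (B ++ [ b ]) w-free left (inj₂ ((λ ()) ∘ ++-conicalʳ B [ b ]))
    u-right : Unique (b ∷ reverse B ++ [ c ])
    u-right = subst Unique (reverse-framed c B b)
                (Unique-resp-↭ (↭-sym (↭-reverse _)) (Unique-infix (a ∷ A) _ [] (subst Unique right u)))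
    free-right : Free (b ∷ reverse B ++ [ c ])
    free-right = subst Free (reverse-framed c B b)
                       (free-reverse (properlyFree⇒free (a ∷ A) [] w-free right (inj₁ λ ())))

>-connected : ∀ {p q} → ¬ p > q → p ≢ q → q > p
>-connected p≯q p≢q = ≤∧≢⇒< (≮⇒≥ p≯q) p≢q

<-connected : ∀ {p q} → ¬ p < q → p ≢ q → q < p
<-connected p≮q p≢q = ≤∧≢⇒< (≮⇒≥ p≮q) (≢-sym p≢q)

lemma4 : (n : ℕ) → 3 ≤ n → (w : List ℕ) → w ↭ map suc (upTo n) →
    (k : ℕ) → 1 ≤ k → k ≤ n → at w k ≡ n ∸ 2 →
    (PrimitiveG w → PrimitiveG (wL w k) × PrimitiveG (wR w k))
    × (PrimitiveR w → PrimitiveR (wL w k) × PrimitiveR (wR w k))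
lemma4 n 3≤n w w↭ k _ _ wₖ =
  Framed.primitive-wL-wR _>_ >-connected n 3≤n w↭ wₖ ,
  Framed.primitive-wL-wR _<_ <-connected n 3≤n w↭ wₖ
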